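{- Let $p$, $\pi$, $\sigma$ be permutations of lengths $l$, $m$, $n$, and let $j:\{1,\dots,m\}\to\{1,\dots,n\}$ be the index injection of an occurrence of $\pi$ in $\sigma$. Let $\Phi_p:V_p(\pi)\to V_p(\sigma)$ be the injection $\{i_1,\dots,i_l\}\mapsto\{j(i_1),\dots,j(i_l)\}$. Then $\Phi_p$ induces an isomorphism of the occurrence graph $G_p(\pi)$ with a subgraph of $G_p(\sigma)$; that is, for every edge $uv$ of $G_p(\pi)$, $\Phi_p(u)\Phi_p(v)$ is an edge of $G_p(\sigma)$.
   Context: A permutation of length $n$ is a bijection $\{1,\dots,n\}\to\{1,\dots,n\}$. For a permutation $p$ of length $k$ and a permutation $\pi$ of length $n$, an index set of $p$ in $\pi$ is a set $\{i_1<\dots<i_k\}\subseteq\{1,\dots,n\}$ such that $\pi(i_1)\cdots\pi(i_k)$ is order-isomorphic to $p$; the order-preserving map $a\mapsto i_a$ is the index injection of that occurrence. The occurrence set $V_p(\pi)$ is the set of all index sets of $p$ in $\pi$. The occurrence graph $G_p(\pi)$ is the simple undirected graph with vertex set $V_p(\pi)$ in which $u,v$ are adjacent iff $|u\setminus v|=|v\setminus u|=1$. A subgraph of $G=(V,E)$ is a graph $(V',E')$ with $V'\subseteq V$ and $E'\subseteq\{\{u,v\}\in E:u,v\in V'\}$. -}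

module Defs where

open import Data.Nat using (ℕ)
open import Data.Fin using (Fin; _<_; _≟_)
open import Data.Fin.Permutation using (Permutation′; _⟨$⟩ʳ_)
open import Data.Fin.Subset using (Subset; _∈_; _∩_; ∁; ∣_∣)
open import Data.Fin.Subset.Properties using (_∈?_)
open import Data.Fin.Properties using (any?)
open import Data.Vec using (tabulate)
open import Data.Product using (Σ; ∃; _×_)
open import Relation.Nullary using (does)
open import Relation.Nullary.Decidable using (_×-dec_)
open import Relation.Binary.PropositionalEquality using (_≡_)
open import Function.Bundles using (_⇔_)

-- A permutation of length n: a bijection Fin n → Fin n (positions/values 0-based).

StrictlyIncreasing : ∀ {k n} → (Fin k → Fin n) → Set
StrictlyIncreasing ι = ∀ a b → a < b → ι a < ι b

IsIndexInjection : ∀ {k n} → Permutation′ k → Permutation′ n → (Fin k → Fin n) → Set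
IsIndexInjection p π ι =
  StrictlyIncreasing ι ×
  (∀ a b → ((π ⟨$⟩ʳ ι a) < (π ⟨$⟩ʳ ι b)) ⇔ ((p ⟨$⟩ʳ a) < (p ⟨$⟩ʳ b)))

IsImageOf : ∀ {k n} → (Fin k → Fin n) → Subset n → Set
IsImageOf {k} ι S = ∀ y → (y ∈ S) ⇔ (∃ λ (a : Fin k) → ι a ≡ y)

InOccurrenceSet : ∀ {k n} → Permutation′ k → Permutation′ n → Subset n → Set
InOccurrenceSet {k} {n} p π S =
  Σ (Fin k → Fin n) λ ι → IsIndexInjection p π ι × IsImageOf ι S

Adjacent : ∀ {n} → Subset n → Subset n → Set
Adjacent u v = (∣ u ∩ ∁ v ∣ ≡ 1) × (∣ v ∩ ∁ u ∣ ≡ 1)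

image : ∀ {m n} → (Fin m → Fin n) → Subset m → Subset n
image j u = tabulate λ y → does (any? λ x → (x ∈? u) ×-dec (j x ≟ y))

-- Φ_p is the direct image along j. Index injections compose, so the image of an index
-- set of p in π is an index set of p in σ. Since j is strictly increasing it is
-- injective, and the direct image along an injective map is injective on subsets,
-- commutes with u ∩ ∁ v and sends singletons to singletons; hence |u ∖ v| = 1 gives
-- |Φ_p(u) ∖ Φ_p(v)| = 1.
module Submission where

open import Defs
open import Data.Nat using (ℕ; pred)
open import Data.Bool using (true)
open import Data.Fin using (Fin; _≟_)
open import Data.Fin.Permutation using (Permutation′)
open import Data.Fin.Subset using (Subset; _∈_; _∩_; ∁; ∣_∣; ⁅_⁆; ⊥; inside; outside)
open import Data.Fin.Subset.Properties
  using (_∈?_; ⊆-antisym; x∈⁅x⁆; x∈⁅y⁆⇒x≡y; ∣⁅x⁆∣≡1; x∈p∩q⁺; x∈p∩q⁻; x∈∁p⇒x∉p; x∉p⇒x∈∁p)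
open import Data.Fin.Properties using (any?; <-cmp; <⇒≢)
open import Data.Vec using ([]; _∷_; tabulate)
open import Data.Vec.Properties using (lookup∘tabulate; []=⇒lookup; lookup⇒[]=)
open import Data.Product using (_×_; _,_; ∃)
open import Data.Empty using (⊥-elim)
open import Relation.Nullary using (Dec; does; yes; no)
open import Relation.Nullary.Decidable using (_×-dec_)
open import Relation.Binary.PropositionalEquality
open import Relation.Binary.Definitions using (tri<; tri≈; tri>)
open import Function.Base using (_∘_)
open import Function.Bundles using (mk⇔; Equivalence)
open import Function.Definitions using (Injective)

private
  variable
    k m n : ℕ

∣p∣≡0⇒p≡⊥ : ∀ (p : Subset n) → ∣ p ∣ ≡ 0 → p ≡ ⊥
∣p∣≡0⇒p≡⊥ []            _     = refl
∣p∣≡0⇒p≡⊥ (outside ∷ p) ∣p∣≡0 = cong (outside ∷_) (∣p∣≡0⇒p≡⊥ p ∣p∣≡0)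

∣p∣≡1⇒p≡⁅x⁆ : ∀ (p : Subset n) → ∣ p ∣ ≡ 1 → ∃ λ x → p ≡ ⁅ x ⁆
∣p∣≡1⇒p≡⁅x⁆ (inside  ∷ p) ∣p∣≡1 = Fin.zero , cong (inside ∷_) (∣p∣≡0⇒p≡⊥ p (cong pred ∣p∣≡1))
∣p∣≡1⇒p≡⁅x⁆ (outside ∷ p) ∣p∣≡1 with ∣p∣≡1⇒p≡⁅x⁆ p ∣p∣≡1
... | x , refl = Fin.suc x , refl

module _ (j : Fin m → Fin n) where

  private
    image-membership : ∀ u y → Dec (∃ λ x → x ∈ u × j x ≡ y)
    image-membership u y = any? λ x → (x ∈? u) ×-dec (j x ≟ y)

  ∈-image⁻ : ∀ {u y} → y ∈ image j u → ∃ λ x → x ∈ u × j x ≡ y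
  ∈-image⁻ {u} {y} y∈ju =
    decided-witness (trans (sym (lookup∘tabulate (does ∘ image-membership u) y)) ([]=⇒lookup y∈ju))
    where
    decided-witness : does (image-membership u y) ≡ true → ∃ λ x → x ∈ u × j x ≡ y
    decided-witness with image-membership u y
    ... | yes witness = λ _ → witness
    ... | no _        = λ ()

  ∈-image⁺ : ∀ {u x} → x ∈ u → j x ∈ image j u
  ∈-image⁺ {u} {x} x∈u =
    lookup⇒[]= (j x) (image j u)
      (trans (lookup∘tabulate (does ∘ image-membership u) (j x)) decided)
    where
    decided : does (image-membership u (j x)) ≡ true
    decided with image-membership u (j x)
    ... | yes _ = refl
    ... | no ∄x = ⊥-elim (∄x (x , x∈u , refl))

  image-⁅⁆ : ∀ x → image j ⁅ x ⁆ ≡ ⁅ j x ⁆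
  image-⁅⁆ x = ⊆-antisym into onto
    where
    into : ∀ {y} → y ∈ image j ⁅ x ⁆ → y ∈ ⁅ j x ⁆
    into y∈ with ∈-image⁻ y∈
    ... | z , z∈⁅x⁆ , refl rewrite x∈⁅y⁆⇒x≡y x z∈⁅x⁆ = x∈⁅x⁆ (j x)

    onto : ∀ {y} → y ∈ ⁅ j x ⁆ → y ∈ image j ⁅ x ⁆
    onto y∈ rewrite x∈⁅y⁆⇒x≡y (j x) y∈ = ∈-image⁺ (x∈⁅x⁆ x)

  module _ (j-injective : Injective _≡_ _≡_ j) where

    ∈-image⇒∈ : ∀ {v x} → j x ∈ image j v → x ∈ v
    ∈-image⇒∈ {v} jx∈jv with ∈-image⁻ jx∈jv
    ... | z , z∈v , jz≡jx = subst (_∈ v) (j-injective jz≡jx) z∈v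

    image-injective : ∀ {u v} → image j u ≡ image j v → u ≡ v
    image-injective {u} {v} ju≡jv = ⊆-antisym
      (λ x∈u → ∈-image⇒∈ (subst (_ ∈_) ju≡jv (∈-image⁺ x∈u)))
      (λ x∈v → ∈-image⇒∈ (subst (_ ∈_) (sym ju≡jv) (∈-image⁺ x∈v)))

    image-∩∁ : ∀ u v → image j (u ∩ ∁ v) ≡ image j u ∩ ∁ (image j v)
    image-∩∁ u v = ⊆-antisym into onto
      where
      into : ∀ {y} → y ∈ image j (u ∩ ∁ v) → y ∈ image j u ∩ ∁ (image j v)
      into y∈ with ∈-image⁻ y∈
      ... | x , x∈u∩∁v , refl with x∈p∩q⁻ u (∁ v) x∈u∩∁v
      ... | x∈u , x∈∁v = x∈p∩q⁺
        (∈-image⁺ x∈u , x∉p⇒x∈∁p (x∈∁p⇒x∉p x∈∁v ∘ ∈-image⇒∈))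

      onto : ∀ {y} → y ∈ image j u ∩ ∁ (image j v) → y ∈ image j (u ∩ ∁ v)
      onto y∈ with x∈p∩q⁻ (image j u) (∁ (image j v)) y∈
      ... | y∈ju , y∈∁jv with ∈-image⁻ y∈ju
      ... | x , x∈u , refl =
        ∈-image⁺ (x∈p∩q⁺ (x∈u , x∉p⇒x∈∁p (x∈∁p⇒x∉p y∈∁jv ∘ ∈-image⁺)))

image-∣∣≡1 : (j : Fin m → Fin n) → ∀ {p} → ∣ p ∣ ≡ 1 → ∣ image j p ∣ ≡ 1
image-∣∣≡1 j {p} ∣p∣≡1 with ∣p∣≡1⇒p≡⁅x⁆ p ∣p∣≡1
... | x , refl = trans (cong ∣_∣ (image-⁅⁆ j x)) (∣⁅x⁆∣≡1 (j x))

image-preserves-Adjacent : (j : Fin m → Fin n) → Injective _≡_ _≡_ j →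
  ∀ {u v} → Adjacent u v → Adjacent (image j u) (image j v)
image-preserves-Adjacent j j-injective {u} {v} (∣u∖v∣≡1 , ∣v∖u∣≡1) =
  subst (λ w → ∣ w ∣ ≡ 1) (image-∩∁ j j-injective u v) (image-∣∣≡1 j ∣u∖v∣≡1) ,
  subst (λ w → ∣ w ∣ ≡ 1) (image-∩∁ j j-injective v u) (image-∣∣≡1 j ∣v∖u∣≡1)

strictlyIncreasing⇒injective : {j : Fin m → Fin n} → StrictlyIncreasing j → Injective _≡_ _≡_ j
strictlyIncreasing⇒injective {j = j} increasing {x} {z} jx≡jz with <-cmp x z
... | tri< x<z _ _ = ⊥-elim (<⇒≢ (increasing x z x<z) jx≡jz)
... | tri≈ _ x≡z _ = x≡z
... | tri> _ _ z<x = ⊥-elim (<⇒≢ (increasing z x z<x) (sym jx≡jz))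

IsIndexInjection-∘ : ∀ {p : Permutation′ k} {π : Permutation′ m} {σ : Permutation′ n}
  {ι : Fin k → Fin m} {j : Fin m → Fin n} →
  IsIndexInjection p π ι → IsIndexInjection π σ j → IsIndexInjection p σ (j ∘ ι)
IsIndexInjection-∘ {ι = ι} (ι-increasing , ι-pattern) (j-increasing , j-pattern) =
  (λ a b a<b → j-increasing (ι a) (ι b) (ι-increasing a b a<b)) ,
  (λ a b → mk⇔
    (Equivalence.to (ι-pattern a b) ∘ Equivalence.to (j-pattern (ι a) (ι b)))
    (Equivalence.from (j-pattern (ι a) (ι b)) ∘ Equivalence.from (ι-pattern a b)))

IsImageOf-image : {ι : Fin k → Fin m} (j : Fin m → Fin n) {u : Subset m} →
  IsImageOf ι u → IsImageOf (j ∘ ι) (image j u)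
IsImageOf-image {ι = ι} j {u} ι-image y = mk⇔ into onto
  where
  into : y ∈ image j u → ∃ λ a → j (ι a) ≡ y
  into y∈ju with ∈-image⁻ j y∈ju
  ... | x , x∈u , refl with Equivalence.to (ι-image x) x∈u
  ... | a , refl = a , refl

  onto : (∃ λ a → j (ι a) ≡ y) → y ∈ image j u
  onto (a , refl) = ∈-image⁺ j (Equivalence.from (ι-image (ι a)) (a , refl))

image-preserves-InOccurrenceSet : ∀ {p : Permutation′ k} {π : Permutation′ m} {σ : Permutation′ n}
  {j : Fin m → Fin n} → IsIndexInjection π σ j →
  ∀ {u} → InOccurrenceSet p π u → InOccurrenceSet p σ (image j u)
image-preserves-InOccurrenceSet {p = p} {π} {σ} {j} j-occurrence (ι , ι-occurrence , ι-image) =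
  j ∘ ι , IsIndexInjection-∘ {p = p} {π = π} {σ = σ} ι-occurrence j-occurrence , IsImageOf-image j ι-image

proposition5p2 : (l m n : ℕ) (p : Permutation′ l) (π : Permutation′ m) (σ : Permutation′ n)
    (j : Fin m → Fin n) → IsIndexInjection π σ j →
    (∀ (u : Subset m) → InOccurrenceSet p π u → InOccurrenceSet p σ (image j u)) ×
    (∀ (u v : Subset m) → InOccurrenceSet p π u → InOccurrenceSet p π v →
      image j u ≡ image j v → u ≡ v) ×
    (∀ (u v : Subset m) → InOccurrenceSet p π u → InOccurrenceSet p π v →
      Adjacent u v → Adjacent (image j u) (image j v))
proposition5p2 l m n p π σ j j-occurrence@(j-increasing , _) =
  (λ _ → image-preserves-InOccurrenceSet {p = p} {π} {σ} j-occurrence) ,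
  (λ _ _ _ _ → image-injective j j-injective) ,
  (λ _ _ _ _ → image-preserves-Adjacent j j-injective)
  where
  j-injective : Injective _≡_ _≡_ j
  j-injective = strictlyIncreasing⇒injective j-increasing
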